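{- (Completeness.) Let $N$ be a $\beta$-normal form with $\Gamma\vdash_{SM_r}N:\sigma$, and let $(\Gamma',\sigma')=\mathtt{Infer}(N)$. Then there exists a type substitution $s$ such that $s(\Gamma')=\Gamma$ and $s(\sigma')=\sigma$.
   Context: Terms (de Bruijn): $M,N::=\underline{n}\mid (M\,N)\mid\lambda.M$, $n\in\mathbb{N}^*$; application associates to the left. A $\beta$-normal form is a term with no subterm of the form $((\lambda.M)\,N)$; these are exactly the terms $\underline{n}$, $\lambda.N'$ with $N'$ a $\beta$-normal form, and $\underline{n}\,N_1\cdots N_m$ with each $N_j$ a $\beta$-normal form. Types: $\mathcal{A}$ is a denumerable set of type variables; $\tau,\sigma\in\mathcal{T}::=\alpha\mid u\to\tau$ and $u\in\mathcal{U}::=\omega\mid u\wedge u\mid\tau$, with $\wedge$ commutative, associative and with neutral element $\omega$; $\to$ associates to the right. Contexts: $\Gamma::=nil\mid u.\Gamma$; $\omega^{k}.\Gamma$ is $\Gamma$ prefixed by $k$ copies of $\omega$. Intersection of contexts: $nil\wedge\Gamma=\Gamma\wedge nil=\Gamma$, $(u_1.\Gamma)\wedge(u_2.\Delta)=(u_1\wedge u_2).(\Gamma\wedge\Delta)$. A type substitution is a map $s:\mathcal{A}\to\mathcal{T}$, extended by $s(\omega)=\omega$, $s(u\wedge v)=s(u)\wedge s(v)$, $s(u\to\tau)=s(u)\to s(\tau)$, $s(nil)=nil$, $s(u.\Gamma)=s(u).s(\Gamma)$. System $SM_r$ derives judgements $\Gamma\vdash M:\tau$ by: (var$_r$) $(\sigma_1\to\cdots\to\sigma_n\to\alpha).nil\vdash\underline{1}:\sigma_1\to\cdots\to\sigma_n\to\alpha$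 ($n\ge0$, $\sigma_i\in\mathcal{T}$, $\alpha\in\mathcal{A}$); (varn) from $\Gamma\vdash\underline{n}:\tau$ infer $\omega.\Gamma\vdash\underline{n+1}:\tau$; ($\to_i$) from $u.\Gamma\vdash M:\tau$ infer $\Gamma\vdash\lambda.M:u\to\tau$; ($\to_i'$) from $nil\vdash M:\tau$ infer $nil\vdash\lambda.M:\omega\to\tau$; ($\to_e'$) from $\Gamma\vdash M_1:\omega\to\tau$ and $\Delta\vdash M_2:\sigma$ infer $\Gamma\wedge\Delta\vdash(M_1\,M_2):\tau$; ($\to_e$) from $\Gamma\vdash M_1:(\sigma_1\wedge\cdots\wedge\sigma_n)\to\tau$ ($n\ge1$, $\sigma_i\in\mathcal{T}$) and $\Delta^i\vdash M_2:\sigma_i$ for all $i$ infer $\Gamma\wedge\Delta^1\wedge\cdots\wedge\Delta^n\vdash(M_1\,M_2):\tau$. The algorithm $\mathtt{Infer}$ on $\beta$-normal forms: $\mathtt{Infer}(\underline{n})=(\omega^{n-1}.\alpha.nil,\alpha)$ with $\alpha$ fresh; $\mathtt{Infer}(\lambda.N')$: let $(\Gamma',\sigma)=\mathtt{Infer}(N')$; if $\Gamma'=u.\Gamma$ return $(\Gamma,u\to\sigma)$, otherwise return $(nil,\omega\to\sigma)$; $\mathtt{Infer}(\underline{n}\,N_1\cdots N_m)$ ($m\ge1$): let $(\Gamma^i,\sigma_i)=\mathtt{Infer}(N_i)$ and $\alpha$ fresh; return $((\omega^{n-1}.(\sigma_1\to\cdots\to\sigma_m\to\alpha).nil)\wedge\Gamma^1\wedge\cdots\wedge\Gamma^m,\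 \alpha)$. "Fresh" means never chosen before, so distinct calls produce disjoint sets of type variables. -}

module Defs where

open import Data.Nat using (ℕ; zero; suc)
open import Data.List using (List; []; _∷_; _++_)
open import Data.Product using (_×_; _,_; Σ; ∃)
open import Data.List.Relation.Binary.Pointwise using (Pointwise)

-- Terms (de Bruijn).  `var k` denotes the index \underline{k+1}
-- (0-based encoding of n ∈ ℕ*).

data Term : Set where
  var : ℕ → Term
  app : Term → Term → Term
  lam : Term → Term

-- β-normal forms, by their grammar:
--   λ.N'   and   \underline{n} N₁ ⋯ N_m  (m ≥ 0; m = 0 is the variable)

data Nf : Set where
  nlam  : Nf → Nf
  nhead : ℕ → List Nf → Nf

apps : Term → List Term → Term
apps M []       = M
apps M (N ∷ Ns) = apps (app M N) Ns

mutual
  ⌜_⌝ : Nf → Term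
  ⌜ nlam N ⌝     = lam ⌜ N ⌝
  ⌜ nhead k Ns ⌝ = apps (var k) ⌜ Ns ⌝*

  ⌜_⌝* : List Nf → List Term
  ⌜ [] ⌝*     = []
  ⌜ N ∷ Ns ⌝* = ⌜ N ⌝ ∷ ⌜ Ns ⌝*

-- An intersection
-- u = τ₁ ∧ ⋯ ∧ τₙ is represented by the list of its components
-- (ω = [], a single type τ = [ τ ]); ∧ is list append and the
-- commutativity/associativity/unit laws are captured by the equivalence
-- _≈_ / _≈ᵤ_ below (multiset equality, recursively).

data Ty : Set where
  tvar : ℕ → Ty
  arr  : List Ty → Ty → Ty

U : Set
U = List Ty

ω : U
ω = []

_∧_ : U → U → U
_∧_ = _++_

mutual
  data _≈_ : Ty → Ty → Set where
    tvar : ∀ {a} → tvar a ≈ tvar a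
    arr  : ∀ {u v τ σ} → u ≈ᵤ v → τ ≈ σ → arr u τ ≈ arr v σ

  data _≈ᵤ_ : U → U → Set where
    []    : [] ≈ᵤ []
    _∷_   : ∀ {τ σ u v} → τ ≈ σ → u ≈ᵤ v → (τ ∷ u) ≈ᵤ (σ ∷ v)
    swap  : ∀ {τ σ u} → (τ ∷ σ ∷ u) ≈ᵤ (σ ∷ τ ∷ u)
    trans : ∀ {u v w} → u ≈ᵤ v → v ≈ᵤ w → u ≈ᵤ w

arrows : List Ty → Ty → Ty
arrows []       τ = τ
arrows (σ ∷ σs) τ = arr (σ ∷ []) (arrows σs τ)

Ctx : Set
Ctx = List U

_∧ᶜ_ : Ctx → Ctx → Ctx
[]      ∧ᶜ Δ       = Δ
(u ∷ Γ) ∧ᶜ []      = u ∷ Γ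
(u ∷ Γ) ∧ᶜ (v ∷ Δ) = (u ∧ v) ∷ (Γ ∧ᶜ Δ)

ωs : ℕ → Ctx → Ctx
ωs zero    Γ = Γ
ωs (suc k) Γ = ω ∷ ωs k Γ

_≈ᶜ_ : Ctx → Ctx → Set
_≈ᶜ_ = Pointwise _≈ᵤ_

Subst : Set
Subst = ℕ → Ty

mutual
  subT : Subst → Ty → Ty
  subT s (tvar a)  = s a
  subT s (arr u τ) = arr (subU s u) (subT s τ)

  subU : Subst → U → U
  subU s []      = []
  subU s (τ ∷ u) = subT s τ ∷ subU s u

subC : Subst → Ctx → Ctx
subC s []      = []
subC s (u ∷ Γ) = subU s u ∷ subC s Γ

-- System SM_r.  Premises "M₁ : (σ₁ ∧ ⋯ ∧ σₙ) → τ" / "M₁ : ω → τ" are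
-- read modulo the laws of ∧ (the type of M₁ is ≈ to the displayed one).

mutual
  data _⊢_∶_ : Ctx → Term → Ty → Set where
    var-r : ∀ (σs : List Ty) (a : ℕ) →
            ((arrows σs (tvar a) ∷ []) ∷ []) ⊢ var 0 ∶ arrows σs (tvar a)
    varn  : ∀ {Γ k τ} → Γ ⊢ var k ∶ τ → (ω ∷ Γ) ⊢ var (suc k) ∶ τ
    →i    : ∀ {u Γ M τ} → (u ∷ Γ) ⊢ M ∶ τ → Γ ⊢ lam M ∶ arr u τ
    →i′   : ∀ {M τ} → [] ⊢ M ∶ τ → [] ⊢ lam M ∶ arr ω τ
    →e′   : ∀ {Γ Δ M₁ M₂ T τ σ} →
            Γ ⊢ M₁ ∶ T → T ≈ arr ω τ → Δ ⊢ M₂ ∶ σ →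
            (Γ ∧ᶜ Δ) ⊢ app M₁ M₂ ∶ τ
    →e    : ∀ {Γ Δ M₁ M₂ T τ σs} →
            Γ ⊢ M₁ ∶ T → T ≈ arr σs τ → Δ ⊩ M₂ ∶⁺ σs →
            (Γ ∧ᶜ Δ) ⊢ app M₁ M₂ ∶ τ

  data _⊩_∶⁺_ : Ctx → Term → List Ty → Set where
    one  : ∀ {Δ M σ} → Δ ⊢ M ∶ σ → Δ ⊩ M ∶⁺ (σ ∷ [])
    more : ∀ {Δ Δs M σ σs} → Δ ⊢ M ∶ σ → Δs ⊩ M ∶⁺ σs →
           (Δ ∧ᶜ Δs) ⊩ M ∶⁺ (σ ∷ σs)

-- Algorithm Infer.  Freshness is implemented by threading a counter:
-- `infer N c` uses only type variables ≥ c and returns the next unused one.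

record Result : Set where
  constructor res
  field
    ctx  : Ctx
    ty   : Ty
    next : ℕ

mutual
  infer : Nf → ℕ → Result
  infer (nhead k []) c = res (ωs k ((tvar c ∷ []) ∷ [])) (tvar c) (suc c)
  infer (nlam N) c with infer N c
  ... | res (u ∷ Γ) σ c′ = res Γ (arr u σ) c′
  ... | res []      σ c′ = res [] (arr ω σ) c′
  infer (nhead k (N ∷ Ns)) c with inferArgs (N ∷ Ns) (suc c)
  ... | Γs , σs , c′ =
        res (ωs k ((arrows σs (tvar c) ∷ []) ∷ []) ∧ᶜ Γs) (tvar c) c′

  inferArgs : List Nf → ℕ → Ctx × List Ty × ℕ
  inferArgs []       c = [] , [] , c
  inferArgs (N ∷ Ns) c with infer N c
  ... | res Γ σ c′ with inferArgs Ns c′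
  ...   | Γs , σs , c″ = (Γ ∧ᶜ Γs) , (σ ∷ σs) , c″

Infer : Nf → Ctx × Ty
Infer N = Result.ctx (infer N 0) , Result.ty (infer N 0)

-- Induction on the normal form, strengthened so that the substitution may be
-- prescribed on all type variables below the counter: `infer N c` creates its
-- variables from c on, so any substitution extends to one solving N.  For a
-- head variable applied to N₁ ⋯ Nₘ, the head's type in SM_r is ρ₁ → ⋯ → ρₙ → α
-- with single-type domains, so every application in the spine is an instance
-- of →e with exactly one argument type.  The fresh variable of the head is sent
-- to the result type and the arguments are solved from left to right, each
-- solution extending the previous one; this does not disturb the earlier
-- arguments, whose inferred types only mention variables below the counter.
module Submission where

open import Defs
open import Data.Empty using (⊥-elim)
open import Data.List using (List; []; _∷_)
open import Data.List.Properties using (++-assoc)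
open import Data.List.Relation.Binary.Pointwise as Pointwise using (Pointwise; []; _∷_)
open import Data.List.Relation.Unary.All as All using (All; []; _∷_)
open import Data.List.Relation.Unary.All.Properties using (++⁺)
open import Data.Nat using (ℕ; zero; suc; _≤_; _<_; _≟_)
open import Data.Nat.Properties using (≤-refl; ≤-trans; <-≤-trans; <⇒≤; n<1+n; m<n⇒m<1+n; <⇒≢)
open import Data.Product using (Σ; ∃-syntax; _×_; _,_; proj₁; proj₂)
open import Level using (0ℓ)
open import Relation.Binary using (Setoid)
import Relation.Binary.Reasoning.Setoid
open import Relation.Binary.PropositionalEquality as ≡ using (_≡_; _≢_; refl; cong; cong₂)
open import Relation.Nullary using (yes; no)
open import Relation.Unary using (Pred; _⊆_)

private
  variable
    P Q       : Pred ℕ 0ℓ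
    s s′      : Subst
    a c       : ℕ
    τ τ′ ρ    : Ty
    u u′ v v′ : U
    σs ρs     : List Ty
    Γ Γ′ Δ Δ′ : Ctx

mutual
  ≈-refl : τ ≈ τ
  ≈-refl {tvar a}  = tvar
  ≈-refl {arr u τ} = arr ≈ᵤ-refl ≈-refl

  ≈ᵤ-refl : u ≈ᵤ u
  ≈ᵤ-refl {[]}    = []
  ≈ᵤ-refl {τ ∷ u} = ≈-refl ∷ ≈ᵤ-refl

mutual
  ≈-sym : τ ≈ τ′ → τ′ ≈ τ
  ≈-sym tvar      = tvar
  ≈-sym (arr p q) = arr (≈ᵤ-sym p) (≈-sym q)

  ≈ᵤ-sym : u ≈ᵤ u′ → u′ ≈ᵤ u
  ≈ᵤ-sym []          = []
  ≈ᵤ-sym (p ∷ ps)    = ≈-sym p ∷ ≈ᵤ-sym ps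
  ≈ᵤ-sym swap        = swap
  ≈ᵤ-sym (trans p q) = trans (≈ᵤ-sym q) (≈ᵤ-sym p)

≈-trans : ∀ {τ τ′ τ″} → τ ≈ τ′ → τ′ ≈ τ″ → τ ≈ τ″
≈-trans tvar      tvar        = tvar
≈-trans (arr p q) (arr p′ q′) = arr (trans p p′) (≈-trans q q′)

≈-reflexive : τ ≡ τ′ → τ ≈ τ′
≈-reflexive refl = ≈-refl

≈ᵤ-setoid : Setoid 0ℓ 0ℓ
≈ᵤ-setoid = record
  { Carrier       = U
  ; _≈_           = _≈ᵤ_
  ; isEquivalence = record { refl = ≈ᵤ-refl ; sym = ≈ᵤ-sym ; trans = trans }
  }

≈ᶜ-setoid : Setoid 0ℓ 0ℓ
≈ᶜ-setoid = Pointwise.setoid ≈ᵤ-setoid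

module ≈ᶜ-Reasoning = Relation.Binary.Reasoning.Setoid ≈ᶜ-setoid

≈ᵤ-[]ˡ : [] ≈ᵤ u → u ≡ []
≈ᵤ-[]ˡ []          = refl
≈ᵤ-[]ˡ (trans p q) with ≈ᵤ-[]ˡ p
... | refl = ≈ᵤ-[]ˡ q

≈ᵤ-singletonˡ : (ρ ∷ []) ≈ᵤ u → ∃[ σ ] u ≡ σ ∷ [] × ρ ≈ σ
≈ᵤ-singletonˡ (p ∷ ps) with ≈ᵤ-[]ˡ ps
... | refl = _ , refl , p
≈ᵤ-singletonˡ (trans p q) with ≈ᵤ-singletonˡ p
... | _ , refl , ρ≈σ with ≈ᵤ-singletonˡ q
...   | σ′ , refl , σ≈σ′ = σ′ , refl , ≈-trans ρ≈σ σ≈σ′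

∧-cong : u ≈ᵤ u′ → v ≈ᵤ v′ → (u ∧ v) ≈ᵤ (u′ ∧ v′)
∧-cong {u′ = u′} {v = v} p q = trans (congˡ v p) (congʳ u′ q)
  where
  congˡ : ∀ {u u′} v → u ≈ᵤ u′ → (u ∧ v) ≈ᵤ (u′ ∧ v)
  congˡ v []          = ≈ᵤ-refl
  congˡ v (p ∷ ps)    = p ∷ congˡ v ps
  congˡ v swap        = swap
  congˡ v (trans p q) = trans (congˡ v p) (congˡ v q)

  congʳ : ∀ u {v v′} → v ≈ᵤ v′ → (u ∧ v) ≈ᵤ (u ∧ v′)
  congʳ []      p = p
  congʳ (τ ∷ u) p = ≈-refl ∷ congʳ u p

∧ᶜ-cong : Γ ≈ᶜ Γ′ → Δ ≈ᶜ Δ′ → (Γ ∧ᶜ Δ) ≈ᶜ (Γ′ ∧ᶜ Δ′)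
∧ᶜ-cong []       q        = q
∧ᶜ-cong (p ∷ ps) []       = p ∷ ps
∧ᶜ-cong (p ∷ ps) (q ∷ qs) = ∧-cong p q ∷ ∧ᶜ-cong ps qs

ωs-cong : ∀ k → Γ ≈ᶜ Γ′ → ωs k Γ ≈ᶜ ωs k Γ′
ωs-cong zero    p = p
ωs-cong (suc k) p = [] ∷ ωs-cong k p

arrows-cong : Pointwise _≈_ σs ρs → τ ≈ τ′ → arrows σs τ ≈ arrows ρs τ′
arrows-cong []       q = q
arrows-cong (p ∷ ps) q = arr (p ∷ []) (arrows-cong ps q)

∧ᶜ-identityʳ : ∀ Γ → (Γ ∧ᶜ []) ≡ Γ
∧ᶜ-identityʳ []      = refl
∧ᶜ-identityʳ (u ∷ Γ) = refl

∧ᶜ-assoc : ∀ Γ Δ Θ → ((Γ ∧ᶜ Δ) ∧ᶜ Θ) ≡ (Γ ∧ᶜ (Δ ∧ᶜ Θ))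
∧ᶜ-assoc []      Δ       Θ       = refl
∧ᶜ-assoc (u ∷ Γ) []      Θ       = refl
∧ᶜ-assoc (u ∷ Γ) (v ∷ Δ) []      = refl
∧ᶜ-assoc (u ∷ Γ) (v ∷ Δ) (w ∷ Θ) =
  cong₂ _∷_ (++-assoc u v w) (∧ᶜ-assoc Γ Δ Θ)

All-∧ᶜ⁺ : ∀ {Q : Pred Ty 0ℓ} → All (All Q) Γ → All (All Q) Δ → All (All Q) (Γ ∧ᶜ Δ)
All-∧ᶜ⁺ []       qs       = qs
All-∧ᶜ⁺ (p ∷ ps) []       = p ∷ ps
All-∧ᶜ⁺ (p ∷ ps) (q ∷ qs) = ++⁺ p q ∷ All-∧ᶜ⁺ ps qs

All-ωs⁺ : ∀ {Q : Pred Ty 0ℓ} k → All (All Q) Γ → All (All Q) (ωs k Γ)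
All-ωs⁺ zero    ps = ps
All-ωs⁺ (suc k) ps = [] ∷ All-ωs⁺ k ps

subU-∧ : ∀ s u v → subU s (u ∧ v) ≡ (subU s u ∧ subU s v)
subU-∧ s []      v = refl
subU-∧ s (τ ∷ u) v = cong (subT s τ ∷_) (subU-∧ s u v)

subC-∧ᶜ : ∀ s Γ Δ → subC s (Γ ∧ᶜ Δ) ≡ (subC s Γ ∧ᶜ subC s Δ)
subC-∧ᶜ s []      Δ       = refl
subC-∧ᶜ s (u ∷ Γ) []      = refl
subC-∧ᶜ s (u ∷ Γ) (v ∷ Δ) = cong₂ _∷_ (subU-∧ s u v) (subC-∧ᶜ s Γ Δ)

subC-ωs : ∀ s k Γ → subC s (ωs k Γ) ≡ ωs k (subC s Γ)
subC-ωs s zero    Γ = refl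
subC-ωs s (suc k) Γ = cong ([] ∷_) (subC-ωs s k Γ)

subT-arrows : ∀ s σs τ → subT s (arrows σs τ) ≡ arrows (subU s σs) (subT s τ)
subT-arrows s []       τ = refl
subT-arrows s (σ ∷ σs) τ = cong (arr (subT s σ ∷ [])) (subT-arrows s σs τ)

update : Subst → ℕ → Ty → Subst
update s c σ x with x ≟ c
... | yes _ = σ
... | no  _ = s x

update-≡ : ∀ s c σ → update s c σ c ≡ σ
update-≡ s c σ with c ≟ c
... | yes _   = refl
... | no  c≢c = ⊥-elim (c≢c refl)

update-≢ : ∀ s c σ {x} → x ≢ c → update s c σ x ≡ s x
update-≢ s c σ {x} x≢c with x ≟ c
... | yes x≡c = ⊥-elim (x≢c x≡c)
... | no  _   = refl

Agree : Subst → Subst → ℕ → Set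
Agree s s′ n = ∀ {x} → x < n → s x ≡ s′ x

data AllVars (P : Pred ℕ 0ℓ) : Ty → Set where
  tvar : P a → AllVars P (tvar a)
  arr  : All (AllVars P) u → AllVars P τ → AllVars P (arr u τ)

AllVarsᶜ : Pred ℕ 0ℓ → Ctx → Set
AllVarsᶜ P = All (All (AllVars P))

mutual
  AllVars-mono : P ⊆ Q → AllVars P τ → AllVars Q τ
  AllVars-mono f (tvar p)   = tvar (f p)
  AllVars-mono f (arr ps q) = arr (AllVarsᵤ-mono f ps) (AllVars-mono f q)

  AllVarsᵤ-mono : P ⊆ Q → All (AllVars P) u → All (AllVars Q) u
  AllVarsᵤ-mono f []       = []
  AllVarsᵤ-mono f (p ∷ ps) = AllVars-mono f p ∷ AllVarsᵤ-mono f ps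

AllVarsᶜ-mono : P ⊆ Q → AllVarsᶜ P Γ → AllVarsᶜ Q Γ
AllVarsᶜ-mono f = All.map (AllVarsᵤ-mono f)

mutual
  subT-cong : AllVars (λ x → s x ≡ s′ x) τ → subT s τ ≡ subT s′ τ
  subT-cong (tvar p)   = p
  subT-cong (arr ps q) = cong₂ arr (subU-cong ps) (subT-cong q)

  subU-cong : All (AllVars (λ x → s x ≡ s′ x)) u → subU s u ≡ subU s′ u
  subU-cong []       = refl
  subU-cong (p ∷ ps) = cong₂ _∷_ (subT-cong p) (subU-cong ps)

subC-cong : AllVarsᶜ (λ x → s x ≡ s′ x) Γ → subC s Γ ≡ subC s′ Γ
subC-cong []       = refl
subC-cong (p ∷ ps) = cong₂ _∷_ (subU-cong p) (subC-cong ps)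

WellScoped : ℕ → Result → Set
WellScoped c (res Γ σ c′) = c ≤ c′ × AllVarsᶜ (_< c′) Γ × AllVars (_< c′) σ

WellScopedArgs : ℕ → Ctx × List Ty × ℕ → Set
WellScopedArgs c (Γs , σs , c′) = c ≤ c′ × AllVarsᶜ (_< c′) Γs × All (AllVars (_< c′)) σs

headResult : ℕ → ℕ → Ctx × List Ty × ℕ → Result
headResult k c (Γs , σs , c′) = res (ωs k ((arrows σs (tvar c) ∷ []) ∷ []) ∧ᶜ Γs) (tvar c) c′

infer-nhead : ∀ k Ns c → infer (nhead k Ns) c ≡ headResult k c (inferArgs Ns (suc c))
infer-nhead k []       c = cong (λ Γ → res Γ (tvar c) (suc c)) (≡.sym (∧ᶜ-identityʳ _))
infer-nhead k (N ∷ Ns) c = refl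

AllVars-arrows : All (AllVars P) σs → AllVars P τ → AllVars P (arrows σs τ)
AllVars-arrows []       q = q
AllVars-arrows (p ∷ ps) q = arr (p ∷ []) (AllVars-arrows ps q)

headResult-wellScoped : ∀ k r → WellScopedArgs (suc c) r → WellScoped c (headResult k c r)
headResult-wellScoped k (Γs , σs , c′) (c<c′ , Γs< , σs<) =
  <⇒≤ c<c′ , All-∧ᶜ⁺ (All-ωs⁺ k ((AllVars-arrows σs< (tvar c<c′) ∷ []) ∷ [])) Γs< , tvar c<c′

mutual
  infer-wellScoped : ∀ N c → WellScoped c (infer N c)
  infer-wellScoped (nlam N) c with infer N c | infer-wellScoped N c
  ... | res (u ∷ Γ) σ c′ | c≤c′ , u< ∷ Γ< , σ< = c≤c′ , Γ< , arr u< σ<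
  ... | res []      σ c′ | c≤c′ , _        , σ< = c≤c′ , [] , arr [] σ<
  infer-wellScoped (nhead k Ns) c rewrite infer-nhead k Ns c =
    headResult-wellScoped k (inferArgs Ns (suc c)) (inferArgs-wellScoped Ns (suc c))

  inferArgs-wellScoped : ∀ Ns c → WellScopedArgs c (inferArgs Ns c)
  inferArgs-wellScoped []       c = ≤-refl , [] , []
  inferArgs-wellScoped (N ∷ Ns) c with infer N c | infer-wellScoped N c
  ... | res Γ σ c₁ | c≤c₁ , Γ< , σ< with inferArgs Ns c₁ | inferArgs-wellScoped Ns c₁
  ...   | Γs , σs , c₂ | c₁≤c₂ , Γs< , σs< =
          ≤-trans c≤c₁ c₁≤c₂ , All-∧ᶜ⁺ (AllVarsᶜ-mono weaken Γ<) Γs< , AllVars-mono weaken σ< ∷ σs<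
    where
    weaken : (_< c₁) ⊆ (_< c₂)
    weaken x<c₁ = <-≤-trans x<c₁ c₁≤c₂

var-inversion : ∀ k → Γ ⊢ var k ∶ τ →
  ∃[ ρs ] ∃[ a ] Γ ≡ ωs k ((arrows ρs (tvar a) ∷ []) ∷ []) × τ ≡ arrows ρs (tvar a)
var-inversion zero    (var-r ρs a) = ρs , a , refl , refl
var-inversion (suc k) (varn d) with var-inversion k d
... | ρs , a , refl , refl = ρs , a , refl , refl

-- Spine Γ T Ns Γ′ τ: a head typed T in Γ, applied to Ns, is typed τ in Γ′.
data Spine : Ctx → Ty → List Term → Ctx → Ty → Set where
  []    : Spine Γ τ [] Γ τ
  ω-arg : ∀ {N Ns σ T} → T ≈ arr ω τ → Δ ⊢ N ∶ σ →
          Spine (Γ ∧ᶜ Δ) τ Ns Γ′ τ′ → Spine Γ T (N ∷ Ns) Γ′ τ′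
  arg   : ∀ {N Ns T} → T ≈ arr σs τ → Δ ⊩ N ∶⁺ σs →
          Spine (Γ ∧ᶜ Δ) τ Ns Γ′ τ′ → Spine Γ T (N ∷ Ns) Γ′ τ′

apps-inversion : ∀ Ns M → Γ ⊢ apps M Ns ∶ τ → ∃[ Γ₀ ] ∃[ T ] Γ₀ ⊢ M ∶ T × Spine Γ₀ T Ns Γ τ
apps-inversion []       M d = _ , _ , d , []
apps-inversion (N ∷ Ns) M d with apps-inversion Ns (app M N) d
... | _ , _ , →e′ dM eq dN  , sp = _ , _ , dM , ω-arg eq dN sp
... | _ , _ , →e  dM eq dsN , sp = _ , _ , dM , arg eq dsN sp

data _⊢*_∶_ : Ctx → List Term → List Ty → Set where
  []  : [] ⊢* [] ∶ []
  _∷_ : ∀ {Δs N Ns σ} → Δ ⊢ N ∶ σ → Δs ⊢* Ns ∶ σs → (Δ ∧ᶜ Δs) ⊢* (N ∷ Ns) ∶ (σ ∷ σs)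

spine⇒args : ∀ ρs a {Γ₀ T Ns} → Spine Γ₀ T Ns Γ τ → arrows ρs (tvar a) ≈ T →
  ∃[ Δ ] ∃[ σs ] (Δ ⊢* Ns ∶ σs) × Γ ≡ Γ₀ ∧ᶜ Δ × arrows ρs (tvar a) ≈ arrows σs τ
spine⇒args ρs a [] eq = [] , [] , [] , ≡.sym (∧ᶜ-identityʳ _) , eq
spine⇒args [] a (ω-arg eq _ _) eq′ with ≈-trans eq′ eq
... | ()
spine⇒args (ρ ∷ ρs) a (ω-arg eq _ _) eq′ with ≈-trans eq′ eq
... | arr p _ with ≈ᵤ-singletonˡ p
...   | _ , () , _
spine⇒args [] a (arg eq _ _) eq′ with ≈-trans eq′ eq
... | ()
spine⇒args (ρ ∷ ρs) a {Γ₀} (arg {Δ = Δ} eq dsN sp) eq′ with ≈-trans eq′ eq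
... | arr p q with ≈ᵤ-singletonˡ p | dsN
...   | σ , refl , ρ≈σ | one dN with spine⇒args ρs a sp q
...     | Δs , σs , ds , refl , ρs≈σs =
          Δ ∧ᶜ Δs , σ ∷ σs , dN ∷ ds , ∧ᶜ-assoc Γ₀ Δ Δs , arr (ρ≈σ ∷ []) ρs≈σs

head-inversion : ∀ k Ns → Γ ⊢ apps (var k) Ns ∶ τ →
  ∃[ ρ ] ∃[ Δ ] ∃[ σs ] (Δ ⊢* Ns ∶ σs) × Γ ≡ ωs k ((ρ ∷ []) ∷ []) ∧ᶜ Δ × ρ ≈ arrows σs τ
head-inversion k Ns d with apps-inversion Ns (var k) d
... | _ , _ , dk , sp with var-inversion k dk
...   | ρs , a , refl , refl with spine⇒args ρs a sp ≈-refl
...     | Δ , σs , ds , refl , ρ≈ = arrows ρs (tvar a) , Δ , σs , ds , refl , ρ≈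

IsInstance : Subst → Result → Ctx → Ty → Set
IsInstance s (res Γ′ σ′ _) Γ σ = subC s Γ′ ≈ᶜ Γ × subT s σ′ ≈ σ

IsArgsInstance : Subst → Ctx × List Ty × ℕ → Ctx → List Ty → Set
IsArgsInstance s (Γs′ , σs′ , _) Δ σs = subC s Γs′ ≈ᶜ Δ × Pointwise _≈_ (subU s σs′) σs

headResult-instance : ∀ k c r s₀ {τ ρ Δ σs} → ρ ≈ arrows σs τ →
  (∃[ s ] Agree (update s₀ c τ) s (suc c) × IsArgsInstance s r Δ σs) →
  ∃[ s ] Agree s₀ s c × IsInstance s (headResult k c r) (ωs k ((ρ ∷ []) ∷ []) ∧ᶜ Δ) τ
headResult-instance k c (Γs′ , σs′ , _) s₀ {τ} {ρ} {Δ} {σs} ρ≈ (s , agree , Γs≈ , σs≈) =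
  s , agree₀ , ctx≈ , ≈-reflexive sc≡τ
  where
  sc≡τ : s c ≡ τ
  sc≡τ = ≡.trans (≡.sym (agree (n<1+n c))) (update-≡ s₀ c τ)

  agree₀ : Agree s₀ s c
  agree₀ x<c = ≡.trans (≡.sym (update-≢ s₀ c τ (<⇒≢ x<c))) (agree (m<n⇒m<1+n x<c))

  head≈ : subT s (arrows σs′ (tvar c)) ≈ ρ
  head≈ = ≈-trans (≈-reflexive (subT-arrows s σs′ (tvar c)))
                  (≈-trans (arrows-cong σs≈ (≈-reflexive sc≡τ)) (≈-sym ρ≈))

  open ≈ᶜ-Reasoning
  ctx≈ : subC s (ωs k ((arrows σs′ (tvar c) ∷ []) ∷ []) ∧ᶜ Γs′) ≈ᶜ (ωs k ((ρ ∷ []) ∷ []) ∧ᶜ Δ)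
  ctx≈ = begin
    subC s (ωs k ((arrows σs′ (tvar c) ∷ []) ∷ []) ∧ᶜ Γs′)
      ≡⟨ subC-∧ᶜ s (ωs k _) Γs′ ⟩
    subC s (ωs k ((arrows σs′ (tvar c) ∷ []) ∷ [])) ∧ᶜ subC s Γs′
      ≡⟨ cong (_∧ᶜ subC s Γs′) (subC-ωs s k _) ⟩
    ωs k ((subT s (arrows σs′ (tvar c)) ∷ []) ∷ []) ∧ᶜ subC s Γs′
      ≈⟨ ∧ᶜ-cong (ωs-cong k ((head≈ ∷ []) ∷ [])) Γs≈ ⟩
    ωs k ((ρ ∷ []) ∷ []) ∧ᶜ Δ ∎

mutual
  infer-complete : ∀ N c s₀ {Γ σ} → Γ ⊢ ⌜ N ⌝ ∶ σ →
    ∃[ s ] Agree s₀ s c × IsInstance s (infer N c) Γ σ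
  infer-complete (nlam N) c s₀ (→i d) with infer N c | infer-complete N c s₀ d
  ... | res (_ ∷ _) _ _ | s , agree , u≈ ∷ Γ≈ , σ≈ = s , agree , Γ≈ , arr u≈ σ≈
  ... | res []      _ _ | _ , _ , () , _
  infer-complete (nlam N) c s₀ (→i′ d) with infer N c | infer-complete N c s₀ d
  ... | res (_ ∷ _) _ _ | _ , _ , () , _
  ... | res []      _ _ | s , agree , [] , σ≈ = s , agree , [] , arr [] σ≈
  infer-complete (nhead k Ns) c s₀ {σ = σ} d
    rewrite infer-nhead k Ns c with head-inversion k ⌜ Ns ⌝* d
  ... | ρ , Δ , σs , ds , refl , ρ≈ =
    headResult-instance k c (inferArgs Ns (suc c)) s₀ ρ≈
      (inferArgs-complete Ns (suc c) (update s₀ c σ) ds)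

  inferArgs-complete : ∀ Ns c s₀ {Δ σs} → Δ ⊢* ⌜ Ns ⌝* ∶ σs →
    ∃[ s ] Agree s₀ s c × IsArgsInstance s (inferArgs Ns c) Δ σs
  inferArgs-complete []       c s₀ [] = s₀ , (λ _ → refl) , [] , []
  inferArgs-complete (N ∷ Ns) c s₀ (_∷_ {Δ = Δ₁} {Δs = Δs} {σ = σ} dN ds)
    with infer N c | infer-complete N c s₀ dN | infer-wellScoped N c
  ... | res Γ₁ σ₁ c₁ | s₁ , agree₁ , Γ₁≈ , σ₁≈ | c≤c₁ , Γ₁< , σ₁<
    with inferArgs Ns c₁ | inferArgs-complete Ns c₁ s₁ ds
  ... | Γs , _ , _ | s₂ , agree₂ , Γs≈ , σs≈ =
    s₂ , (λ x<c → ≡.trans (agree₁ x<c) (agree₂ (<-≤-trans x<c c≤c₁))) , ctx≈ , σ≈ ∷ σs≈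
    where
    open ≈ᶜ-Reasoning
    ctx≈ : subC s₂ (Γ₁ ∧ᶜ Γs) ≈ᶜ (Δ₁ ∧ᶜ Δs)
    ctx≈ = begin
      subC s₂ (Γ₁ ∧ᶜ Γs)       ≡⟨ subC-∧ᶜ s₂ Γ₁ Γs ⟩
      subC s₂ Γ₁ ∧ᶜ subC s₂ Γs ≡⟨ cong (_∧ᶜ subC s₂ Γs) (subC-cong (AllVarsᶜ-mono agree₂ Γ₁<)) ⟨
      subC s₁ Γ₁ ∧ᶜ subC s₂ Γs ≈⟨ ∧ᶜ-cong Γ₁≈ Γs≈ ⟩
      Δ₁ ∧ᶜ Δs                 ∎

    σ≈ : subT s₂ σ₁ ≈ σ
    σ≈ = ≈-trans (≈-reflexive (≡.sym (subT-cong (AllVars-mono agree₂ σ₁<)))) σ₁≈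

theorem2p11 : (N : Nf) (Γ : Ctx) (σ : Ty) → Γ ⊢ ⌜ N ⌝ ∶ σ →
    Σ Subst (λ s → (subC s (proj₁ (Infer N)) ≈ᶜ Γ) × (subT s (proj₂ (Infer N)) ≈ σ))
theorem2p11 N Γ σ d with infer-complete N 0 tvar d
... | s , _ , inst = s , inst
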